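{- Let $n\ge 4$ and $1\le k\le n$. Let $t=[t_1\cdots t_{n-1}]$ be an injective word of length $n-1$ in $[n]$ not containing the letter $k$, let $1\le i\le\lambda(t)$ with $i\neq k$, and set $s=\sigma_i(t)$. Then $J_1(t)\cap[i,n-1]\neq\emptyset$, so we may set $b=\min(J_1(t)\cap[i,n-1])$ and $t'=\partial_{b+1}(s)$. Then $i\le b\le\lambda(t)$, the word $t'$ does not contain the letter $b+1$, and $$J_0(t')=J_0(t)\cap\big([\rho(t),i-1]\cup[\max\{\rho(t),b+1\},n-1]\big).$$ Moreover: (i) if $b=\lambda(t)$ then $\lambda(t')<\lambda(t)$ (possibly $\lambda(t')=0$); (ii) if $b<\lambda(t)$ then $\lambda(t')=\lambda(t)$ and $\overleftarrow{\delta}(J_1(t))<_L\overleftarrow{\delta}(J_1(t'))$.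
   Context: Intervals are in $\mathbb Z$. For an injective word $t$ of length $n-1$ missing letter $k$ and $1\le i\le n$, $\sigma_i(t)=[t_1\cdots t_{i-1}\,k\,t_i\cdots t_{n-1}]$. For a word $s$ of length $m$ and $1\le j\le m$, $\partial_j(s)$ is the word obtained by deleting the $j$-th letter. $J_0(t)=\{1\le j\le n-1:t_j=j\}$, $J_1(t)=\{1\le j\le n-1:t_j=j+1\}$, $\lambda(t)=\max(J_1(t)\cup\{0\})$, $\rho(t)=\min(J_0(t)\cup\{n\})$. For $J\subseteq\{1,\dots,n-1\}$, write $J\cup\{0\}=\{j_1>\dots>j_p>j_{p+1}=0\}$ and set $\overleftarrow{\delta}(J)=(j_1-j_2,\dots,j_p-j_{p+1})$, a word in the alphabet $\{1,\dots,n-1\}$. $<_L$ is the strict lexicographic (left to right) order on the set of all finite words (including the empty word) in the alphabet $\{1,\dots,n-1\}$. -}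

module Defs where

open import Data.Nat using (ℕ; zero; suc; _≤_; _<_; _∸_; _⊔_; _⊓_; _≟_)
open import Data.List using (List; []; _∷_; length; map; filter; upTo; foldr; reverse)
open import Data.List.Relation.Binary.Lex.Strict using (Lex-<)
open import Relation.Binary.PropositionalEquality using (_≡_)

-- A word is a list of natural numbers (letters); positions are 1-indexed.

-- the j-th letter t_j of a word (1-indexed); 0 outside the range [1, length t]
at : List ℕ → ℕ → ℕ
at []       _             = 0
at (x ∷ xs) zero          = 0
at (x ∷ xs) (suc zero)    = x
at (x ∷ xs) (suc (suc j)) = at xs (suc j)

-- σ_i(t) for the missing letter k : insert k so that it becomes the i-th letter
σ : ℕ → ℕ → List ℕ → List ℕ
σ zero          k t        = k ∷ t
σ (suc zero)    k t        = k ∷ t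
σ (suc (suc i)) k []       = k ∷ []
σ (suc (suc i)) k (x ∷ xs) = x ∷ σ (suc i) k xs

∂ : ℕ → List ℕ → List ℕ
∂ _             []       = []
∂ zero          (x ∷ xs) = x ∷ xs
∂ (suc zero)    (x ∷ xs) = xs
∂ (suc (suc j)) (x ∷ xs) = x ∷ ∂ (suc j) xs

range1 : ℕ → List ℕ
range1 m = map suc (upTo m)

J₀ : List ℕ → List ℕ
J₀ t = filter (λ j → at t j ≟ j) (range1 (length t))

J₁ : List ℕ → List ℕ
J₁ t = filter (λ j → at t j ≟ suc j) (range1 (length t))

lam : List ℕ → ℕ
lam t = foldr _⊔_ 0 (J₁ t)

rho : ℕ → List ℕ → ℕ
rho n t = foldr _⊓_ n (J₀ t)

diffs : ℕ → List ℕ → List ℕ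
diffs prev []       = []
diffs prev (x ∷ xs) = (x ∸ prev) ∷ diffs x xs

δ⃖ : List ℕ → List ℕ
δ⃖ J = reverse (diffs 0 J)

_<L_ : List ℕ → List ℕ → Set
_<L_ = Lex-< _≡_ _<_

module Submission where

-- Deleting position b+1 of σ_i t removes the letter t_b = b+1, so t′ agrees
-- with t below i and above b, has t′_i = k, and carries t_i … t_{b−1} one place to the right. A fixed
-- point of t′ at a shifted position j+1 would make j a point of J₁ t in [i, b), against the choice of b,
-- and i is not fixed since k ≠ i; this gives J₀(t′). Above b, J₁ is unchanged, and b leaves J₁ because
-- b+1 no longer occurs; so λ drops when b = λ(t) and is kept otherwise. In the latter case δ⃖ lists the
-- gaps from the top: those above the least r ∈ J₁ t with r > b coincide, and the next one grows from
-- r − b to r − b′, where b′ < b is the predecessor of r in J₁ t′ (or 0).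

open import Defs
open import Data.Nat using (ℕ; zero; suc; _+_; _≤_; _<_; _⊔_; _⊓_; _∸_; _≟_; _<?_; z≤n; s≤s; z<s; >-nonZero)
open import Data.Nat.Properties
open import Data.List using (List; []; _∷_; _++_; [_]; _∷ʳ_; length; map; filter; foldr; reverse; upTo)
open import Data.List.Properties
  using (++-assoc; ++-identityʳ; map-++; filter-++; filter-accept; reverse-++; unfold-reverse; upTo-∷ʳ;
         foldr-preservesᵇ; foldr-preservesᵒ)
open import Data.List.Membership.Propositional using (_∈_; _∉_)
open import Data.List.Membership.DecPropositional _≟_ using (_∈?_)
open import Data.List.Membership.Propositional.Properties
  using (∈-map⁺; ∈-map⁻; ∈-upTo⁺; ∈-upTo⁻; ∈-filter⁺; ∈-filter⁻; foldr-selective)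
open import Data.List.Relation.Unary.Any as Any using (here; there)
open import Data.List.Relation.Unary.All as All using (All; []; _∷_)
open import Data.List.Relation.Unary.AllPairs using (_∷_)
open import Data.List.Relation.Unary.Unique.Propositional using (Unique)
open import Data.List.Relation.Binary.Lex.Core using (this; next)
open import Data.Product using (Σ; ∃; _×_; _,_; proj₁; proj₂)
open import Data.Sum using (_⊎_; inj₁; inj₂; [_,_]′)
open import Data.Empty using (⊥; ⊥-elim)
open import Function using (_∘_)
open import Function.Bundles using (_⇔_; mk⇔; Equivalence)
open import Level using (0ℓ)
open import Relation.Nullary using (¬_; yes; no)
open import Relation.Unary using (Pred; Decidable)
open import Relation.Binary.Definitions using (tri<; tri≈; tri>)
open import Relation.Binary.PropositionalEquality
  using (_≡_; _≢_; refl; sym; trans; cong; subst; subst₂; module ≡-Reasoning)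

≤-foldr-⊔ : ∀ {x xs} → x ∈ xs → x ≤ foldr _⊔_ 0 xs
≤-foldr-⊔ {x} x∈xs =
  foldr-preservesᵒ {P = x ≤_} (λ m n → [ m≤n⇒m≤n⊔o n , m≤n⇒m≤o⊔n m ]′) 0 _ (inj₂ (Any.map ≤-reflexive x∈xs))

foldr-⊔-≤ : ∀ {c xs} → All (_≤ c) xs → foldr _⊔_ 0 xs ≤ c
foldr-⊔-≤ = foldr-preservesᵇ {P = _≤ _} ⊔-lub z≤n

foldr-⊔-< : ∀ {c xs} → 0 < c → All (_< c) xs → foldr _⊔_ 0 xs < c
foldr-⊔-< = foldr-preservesᵇ {P = _< _} ⊔-lub

foldr-⊔-∈ : ∀ {xs} → 0 < foldr _⊔_ 0 xs → foldr _⊔_ 0 xs ∈ xs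
foldr-⊔-∈ {xs} 0<max with foldr-selective ⊔-sel 0 xs
... | inj₁ max≡0  = ⊥-elim (<⇒≢ 0<max (sym max≡0))
... | inj₂ max∈xs = max∈xs

foldr-⊓-≤ : ∀ {e x xs} → x ∈ xs → foldr _⊓_ e xs ≤ x
foldr-⊓-≤ {e} {x} x∈xs =
  foldr-preservesᵒ {P = _≤ x} (λ m n → [ m≤n⇒m⊓o≤n n , m≤n⇒o⊓m≤n m ]′) e _
    (inj₂ (Any.map (≤-reflexive ∘ sym) x∈xs))

∈-range1⁺ : ∀ {j m} → 1 ≤ j → j ≤ m → j ∈ range1 m
∈-range1⁺ {suc j} _ j<m = ∈-map⁺ suc (∈-upTo⁺ j<m)

∈-range1⁻ : ∀ {j m} → j ∈ range1 m → 1 ≤ j × j ≤ m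
∈-range1⁻ j∈ with ∈-map⁻ suc j∈
... | _ , x∈ , refl = z<s , ∈-upTo⁻ x∈

range1-∷ʳ : ∀ m → range1 (suc m) ≡ range1 m ∷ʳ suc m
range1-∷ʳ m = trans (cong (map suc) (sym (upTo-∷ʳ m))) (map-++ suc (upTo m) [ m ])

range1-+ : ∀ b d → range1 (b + d) ≡ range1 b ++ map (b +_) (range1 d)
range1-+ b zero rewrite +-identityʳ b = sym (++-identityʳ (range1 b))
range1-+ b (suc d) = begin
  range1 (b + suc d)                                     ≡⟨ cong range1 (+-suc b d) ⟩
  range1 (suc (b + d))                                   ≡⟨ range1-∷ʳ (b + d) ⟩
  range1 (b + d) ∷ʳ suc (b + d)                          ≡⟨ cong (_∷ʳ suc (b + d)) (range1-+ b d) ⟩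
  (range1 b ++ map (b +_) (range1 d)) ∷ʳ suc (b + d)     ≡⟨ ++-assoc (range1 b) _ _ ⟩
  range1 b ++ (map (b +_) (range1 d) ∷ʳ suc (b + d))     ≡⟨ cong (λ x → range1 b ++ (map (b +_) (range1 d) ∷ʳ x)) (sym (+-suc b d)) ⟩
  range1 b ++ (map (b +_) (range1 d) ∷ʳ (b + suc d))     ≡⟨ cong (range1 b ++_) (sym (map-++ (b +_) (range1 d) [ suc d ])) ⟩
  range1 b ++ map (b +_) (range1 d ∷ʳ suc d)             ≡⟨ cong (λ xs → range1 b ++ map (b +_) xs) (sym (range1-∷ʳ d)) ⟩
  range1 b ++ map (b +_) (range1 (suc d))                ∎
  where open ≡-Reasoning

∈-shifted-range1⁺ : ∀ {b d j} → b < j → j ≤ b + d → j ∈ map (b +_) (range1 d)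
∈-shifted-range1⁺ {b} {d} {j} b<j j≤b+d =
  subst (_∈ map (b +_) (range1 d)) (m+[n∸m]≡n (<⇒≤ b<j))
    (∈-map⁺ (b +_) (∈-range1⁺ (m<n⇒0<n∸m b<j) (subst (j ∸ b ≤_) (m+n∸m≡n b d) (∸-monoˡ-≤ b j≤b+d))))

∈-shifted-range1⁻ : ∀ {b d j} → j ∈ map (b +_) (range1 d) → b < j × j ≤ b + d
∈-shifted-range1⁻ {b} j∈ with ∈-map⁻ (b +_) j∈
... | x , x∈ , refl with ∈-range1⁻ x∈
... | 0<x , x≤d = m<m+n b 0<x , +-monoʳ-≤ b x≤d

lastOr : ℕ → List ℕ → ℕ
lastOr p []       = p
lastOr p (x ∷ xs) = lastOr x xs

lastOr-∷ʳ : ∀ p xs x → lastOr p (xs ∷ʳ x) ≡ x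
lastOr-∷ʳ p []       x = refl
lastOr-∷ʳ p (y ∷ xs) x = lastOr-∷ʳ y xs x

lastOr-< : ∀ {b p xs} → p < b → All (_< b) xs → lastOr p xs < b
lastOr-< p<b []           = p<b
lastOr-< p<b (x<b ∷ xs<b) = lastOr-< x<b xs<b

diffs-++ : ∀ p xs ys → diffs p (xs ++ ys) ≡ diffs p xs ++ diffs (lastOr p xs) ys
diffs-++ p []       ys = refl
diffs-++ p (x ∷ xs) ys = cong (x ∸ p ∷_) (diffs-++ x xs ys)

δ⃖-++-∷ : ∀ L r R → δ⃖ (L ++ r ∷ R) ≡ reverse (diffs r R) ++ (r ∸ lastOr 0 L) ∷ δ⃖ L
δ⃖-++-∷ L r R = begin
  reverse (diffs 0 (L ++ r ∷ R))                        ≡⟨ cong reverse (diffs-++ 0 L (r ∷ R)) ⟩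
  reverse (diffs 0 L ++ (r ∸ lastOr 0 L) ∷ diffs r R)   ≡⟨ reverse-++ (diffs 0 L) _ ⟩
  reverse ((r ∸ lastOr 0 L) ∷ diffs r R) ++ δ⃖ L        ≡⟨ cong (_++ δ⃖ L) (unfold-reverse _ (diffs r R)) ⟩
  (reverse (diffs r R) ∷ʳ (r ∸ lastOr 0 L)) ++ δ⃖ L     ≡⟨ ++-assoc (reverse (diffs r R)) _ (δ⃖ L) ⟩
  reverse (diffs r R) ++ (r ∸ lastOr 0 L) ∷ δ⃖ L        ∎
  where open ≡-Reasoning

<L-++-∷ : ∀ xs {a c ys zs} → a < c → (xs ++ a ∷ ys) <L (xs ++ c ∷ zs)
<L-++-∷ []       a<c = this a<c
<L-++-∷ (x ∷ xs) a<c = next refl (<L-++-∷ xs a<c)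

δ⃖-++-∷-<L : ∀ {L L′} r R → lastOr 0 L′ < lastOr 0 L → lastOr 0 L ≤ r →
             δ⃖ (L ++ r ∷ R) <L δ⃖ (L′ ++ r ∷ R)
δ⃖-++-∷-<L {L} {L′} r R L′<L L≤r rewrite δ⃖-++-∷ L r R | δ⃖-++-∷ L′ r R =
  <L-++-∷ (reverse (diffs r R)) (∸-monoʳ-< L′<L L≤r)

module _ {P : Pred ℕ 0ℓ} (P? : Decidable P) where

  lastOr-filter-range1-accept : ∀ b → P (suc b) → lastOr 0 (filter P? (range1 (suc b))) ≡ suc b
  lastOr-filter-range1-accept b p = begin
    lastOr 0 (filter P? (range1 (suc b)))               ≡⟨ cong (lastOr 0 ∘ filter P?) (range1-∷ʳ b) ⟩
    lastOr 0 (filter P? (range1 b ∷ʳ suc b))            ≡⟨ cong (lastOr 0) (filter-++ P? (range1 b) [ suc b ]) ⟩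
    lastOr 0 (filter P? (range1 b) ++ filter P? [ suc b ]) ≡⟨ cong (lastOr 0 ∘ (filter P? (range1 b) ++_)) (filter-accept P? p) ⟩
    lastOr 0 (filter P? (range1 b) ∷ʳ suc b)            ≡⟨ lastOr-∷ʳ 0 (filter P? (range1 b)) (suc b) ⟩
    suc b                                               ∎
    where open ≡-Reasoning

  filter-range1-+ : ∀ b d → filter P? (range1 (b + d)) ≡ filter P? (range1 b) ++ filter P? (map (b +_) (range1 d))
  filter-range1-+ b d = trans (cong (filter P?) (range1-+ b d)) (filter-++ P? (range1 b) _)

  lastOr-filter-range1-reject : ∀ b → ¬ P (suc b) → lastOr 0 (filter P? (range1 (suc b))) < suc b
  lastOr-filter-range1-reject b ¬p = lastOr-< z<s (All.tabulate below)
    where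
    below : ∀ {x} → x ∈ filter P? (range1 (suc b)) → x < suc b
    below x∈ with ∈-filter⁻ P? x∈
    ... | x∈range , px = ≤∧≢⇒< (proj₂ (∈-range1⁻ x∈range)) (λ { refl → ¬p px })

module _ {P Q : Pred ℕ 0ℓ} (P? : Decidable P) (Q? : Decidable Q) where

  filter-cong-∈ : ∀ {xs} → (∀ {x} → x ∈ xs → P x ⇔ Q x) → filter P? xs ≡ filter Q? xs
  filter-cong-∈ {[]}     _   = refl
  filter-cong-∈ {x ∷ xs} P⇔Q with P? x | Q? x
  ... | yes _  | yes _ = cong (x ∷_) (filter-cong-∈ (P⇔Q ∘ there))
  ... | no _   | no _  = filter-cong-∈ (P⇔Q ∘ there)
  ... | yes px | no ¬q = ⊥-elim (¬q (Equivalence.to (P⇔Q (here refl)) px))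
  ... | no ¬p  | yes q = ⊥-elim (¬p (Equivalence.from (P⇔Q (here refl)) q))

  δ⃖-filter-range1-+-<L : ∀ b d {c} → (∀ {j} → j ∈ map (suc b +_) (range1 d) → P j ⇔ Q j) →
                          P (suc b) → ¬ Q (suc b) → c ∈ filter P? (map (suc b +_) (range1 d)) →
                          δ⃖ (filter P? (range1 (suc b + d))) <L δ⃖ (filter Q? (range1 (suc b + d)))
  δ⃖-filter-range1-+-<L b d agree pb ¬qb c∈ with filter P? (map (suc b +_) (range1 d)) in eq | c∈
  ... | r ∷ R | _ = subst₂ _<L_ (cong δ⃖ (sym P-split)) (cong δ⃖ (sym Q-split))
    (δ⃖-++-∷-<L {filter P? (range1 (suc b))} {filter Q? (range1 (suc b))} r R
      (subst (_ <_) (sym last-P) (lastOr-filter-range1-reject Q? b ¬qb))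
      (subst (_≤ r) (sym last-P) (<⇒≤ (proj₁ (∈-shifted-range1⁻ r∈)))))
    where
    last-P : lastOr 0 (filter P? (range1 (suc b))) ≡ suc b
    last-P = lastOr-filter-range1-accept P? b pb

    r∈ : r ∈ map (suc b +_) (range1 d)
    r∈ = proj₁ (∈-filter⁻ P? (subst (r ∈_) (sym eq) (here refl)))

    P-split : filter P? (range1 (suc b + d)) ≡ filter P? (range1 (suc b)) ++ r ∷ R
    P-split = trans (filter-range1-+ P? (suc b) d) (cong (_ ++_) eq)

    Q-split : filter Q? (range1 (suc b + d)) ≡ filter Q? (range1 (suc b)) ++ r ∷ R
    Q-split = trans (filter-range1-+ Q? (suc b) d) (cong (_ ++_) (trans (sym (filter-cong-∈ agree)) eq))

  δ⃖-filter-range1-<L : ∀ {m b c} → 1 ≤ b → b ≤ m → (∀ {j} → b < j → j ≤ m → P j ⇔ Q j) →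
                        P b → ¬ Q b → P c → b < c → c ≤ m →
                        δ⃖ (filter P? (range1 m)) <L δ⃖ (filter Q? (range1 m))
  δ⃖-filter-range1-<L {m} {suc b} {c} _ b≤m agree pb ¬qb pc b<c c≤m =
    subst (λ m → δ⃖ (filter P? (range1 m)) <L δ⃖ (filter Q? (range1 m))) b+d≡m
      (δ⃖-filter-range1-+-<L b d agree-above pb ¬qb
        (∈-filter⁺ P? (∈-shifted-range1⁺ b<c (subst (c ≤_) (sym b+d≡m) c≤m)) pc))
    where
    d = m ∸ suc b
    b+d≡m = m+[n∸m]≡n b≤m

    agree-above : ∀ {j} → j ∈ map (suc b +_) (range1 d) → P j ⇔ Q j
    agree-above j∈ with ∈-shifted-range1⁻ j∈
    ... | b<j , j≤b+d = agree b<j (subst (_ ≤_) b+d≡m j≤b+d)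

matchSet : (ℕ → ℕ) → List ℕ → ℕ → List ℕ
matchSet g u m = filter (λ j → at u j ≟ g j) (range1 m)

module _ (g : ℕ → ℕ) (u : List ℕ) (m : ℕ) where

  ∈-matchSet⁺ : ∀ {j} → 1 ≤ j → j ≤ m → at u j ≡ g j → j ∈ matchSet g u m
  ∈-matchSet⁺ 1≤j j≤m = ∈-filter⁺ (λ j → at u j ≟ g j) (∈-range1⁺ 1≤j j≤m)

  ∈-matchSet⁻ : ∀ {j} → j ∈ matchSet g u m → 1 ≤ j × j ≤ m × at u j ≡ g j
  ∈-matchSet⁻ j∈ with ∈-filter⁻ (λ j → at u j ≟ g j) {xs = range1 m} j∈
  ... | j∈range , uj≡gj with ∈-range1⁻ j∈range
  ... | 1≤j , j≤m = 1≤j , j≤m , uj≡gj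

matchSet-transfer : ∀ g u v {m m′ j} → m ≡ m′ → at v j ≡ at u j → j ∈ matchSet g u m → j ∈ matchSet g v m′
matchSet-transfer g u v {m} refl vj≡uj j∈ with ∈-matchSet⁻ g u m j∈
... | 1≤j , j≤m , uj≡gj = ∈-matchSet⁺ g v m 1≤j j≤m (trans vj≡uj uj≡gj)

at-0 : ∀ u → at u 0 ≡ 0
at-0 []      = refl
at-0 (_ ∷ _) = refl

at-∈ : ∀ u {j} → 1 ≤ j → j ≤ length u → at u j ∈ u
at-∈ (x ∷ xs) {suc zero}    _ _         = here refl
at-∈ (x ∷ xs) {suc (suc j)} _ (s≤s j<) = there (at-∈ xs z<s j<)

∈⇒at : ∀ u {x} → x ∈ u → ∃ λ j → 1 ≤ j × j ≤ length u × at u j ≡ x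
∈⇒at (y ∷ ys) (here refl) = 1 , z<s , s≤s z≤n , refl
∈⇒at (y ∷ ys) (there x∈) with ∈⇒at ys x∈
... | suc j , _ , j≤ , ysj≡x = suc (suc j) , z<s , s≤s j≤ , ysj≡x

at-injective : ∀ {u} → Unique u → ∀ {j j′} → 1 ≤ j → j ≤ length u → 1 ≤ j′ → j′ ≤ length u →
               at u j ≡ at u j′ → j ≡ j′
at-injective {x ∷ xs} _ {suc zero} {suc zero} _ _ _ _ _ = refl
at-injective {x ∷ xs} (x∉xs ∷ _) {suc zero} {suc (suc j′)} _ _ _ (s≤s j′<) e =
  ⊥-elim (All.lookup x∉xs (at-∈ xs z<s j′<) e)
at-injective {x ∷ xs} (x∉xs ∷ _) {suc (suc j)} {suc zero} _ (s≤s j<) _ _ e =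
  ⊥-elim (All.lookup x∉xs (at-∈ xs z<s j<) (sym e))
at-injective {x ∷ xs} (_ ∷ uniq) {suc (suc j)} {suc (suc j′)} _ (s≤s j<) _ (s≤s j′<) e =
  cong suc (at-injective uniq z<s j< z<s j′< e)

length-σ : ∀ i k u → length (σ i k u) ≡ suc (length u)
length-σ zero          k u       = refl
length-σ (suc zero)    k u       = refl
length-σ (suc (suc i)) k []      = refl
length-σ (suc (suc i)) k (x ∷ u) = cong suc (length-σ (suc i) k u)

at-σ-< : ∀ i k u {j} → i ≤ suc (length u) → j < i → at (σ i k u) j ≡ at u j
at-σ-< i             k u       {zero}        _         _         = trans (at-0 (σ i k u)) (sym (at-0 u))
at-σ-< (suc zero)    k u       {suc j}       _         (s≤s ())
at-σ-< (suc (suc i)) k []      {suc j}       (s≤s ()) _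
at-σ-< (suc (suc i)) k (x ∷ u) {suc zero}    _         _         = refl
at-σ-< (suc (suc i)) k (x ∷ u) {suc (suc j)} (s≤s i≤) (s≤s j<i) = at-σ-< (suc i) k u i≤ j<i

at-σ-≡ : ∀ i k u → 1 ≤ i → i ≤ suc (length u) → at (σ i k u) i ≡ k
at-σ-≡ (suc zero)    k u       _ _        = refl
at-σ-≡ (suc (suc i)) k (x ∷ u) _ (s≤s i≤) = at-σ-≡ (suc i) k u z<s i≤

at-σ-> : ∀ i k u {j} → 1 ≤ i → i ≤ j → at (σ i k u) (suc j) ≡ at u j
at-σ-> (suc zero)    k u       {suc j}       _ _                = refl
at-σ-> (suc (suc i)) k []      {suc j}       _ _                = refl
at-σ-> (suc (suc i)) k (x ∷ u) {suc (suc j)} _ (s≤s (s≤s i≤j)) = at-σ-> (suc i) k u z<s (s≤s i≤j)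

length-∂ : ∀ b s → suc b ≤ length s → suc (length (∂ (suc b) s)) ≡ length s
length-∂ zero    (x ∷ s) _        = refl
length-∂ (suc b) (x ∷ s) (s≤s b<) = cong suc (length-∂ b s b<)

at-∂-≤ : ∀ b s {j} → j ≤ b → at (∂ (suc b) s) j ≡ at s j
at-∂-≤ b       []                    _         = refl
at-∂-≤ b       (x ∷ s) {zero}        _         = at-0 (∂ (suc b) (x ∷ s))
at-∂-≤ (suc b) (x ∷ s) {suc zero}    _         = refl
at-∂-≤ (suc b) (x ∷ s) {suc (suc j)} (s≤s j≤b) = at-∂-≤ b s j≤b

at-∂-> : ∀ b s {j} → b < j → at (∂ (suc b) s) j ≡ at s (suc j)
at-∂-> b       []                    _         = refl
at-∂-> zero    (x ∷ s) {suc j}       _         = refl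
at-∂-> (suc b) (x ∷ s) {suc (suc j)} (s≤s b<j) = at-∂-> b s b<j

data Region (i b : ℕ) : ℕ → Set where
  before   : ∀ {j} → j < i → Region i b j
  inserted : Region i b i
  shifted  : ∀ {j} → i ≤ j → j < b → Region i b (suc j)
  after    : ∀ {j} → b < j → Region i b j

region : ∀ i b j → Region i b j
region i b j with <-cmp j i
... | tri< j<i _ _               = before j<i
... | tri≈ _ refl _              = inserted
... | tri> _ _ (s≤s {n = j} i≤j) with j <? b
...   | yes j<b = shifted i≤j j<b
...   | no  j≮b = after (s≤s (≮⇒≥ j≮b))

module InsertThenDelete (u : List ℕ) (k i b : ℕ) (1≤i : 1 ≤ i) (i≤b : i ≤ b) (b≤∣u∣ : b ≤ length u) where

  u′ : List ℕ
  u′ = ∂ (suc b) (σ i k u)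

  private
    i≤∣u∣+1 : i ≤ suc (length u)
    i≤∣u∣+1 = m≤n⇒m≤1+n (≤-trans i≤b b≤∣u∣)

  length-u′ : length u′ ≡ length u
  length-u′ = suc-injective (trans (length-∂ b (σ i k u) b<∣σu∣) (length-σ i k u))
    where
    b<∣σu∣ : suc b ≤ length (σ i k u)
    b<∣σu∣ = subst (suc b ≤_) (sym (length-σ i k u)) (s≤s b≤∣u∣)

  at-before : ∀ {j} → j < i → at u′ j ≡ at u j
  at-before j<i = trans (at-∂-≤ b (σ i k u) (≤-trans (<⇒≤ j<i) i≤b)) (at-σ-< i k u i≤∣u∣+1 j<i)

  at-inserted : at u′ i ≡ k
  at-inserted = trans (at-∂-≤ b (σ i k u) i≤b) (at-σ-≡ i k u 1≤i i≤∣u∣+1)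

  at-shifted : ∀ {j} → i ≤ j → j < b → at u′ (suc j) ≡ at u j
  at-shifted i≤j j<b = trans (at-∂-≤ b (σ i k u) j<b) (at-σ-> i k u 1≤i i≤j)

  at-after : ∀ {j} → b < j → at u′ j ≡ at u j
  at-after b<j = trans (at-∂-> b (σ i k u) b<j) (at-σ-> i k u 1≤i (≤-trans i≤b (<⇒≤ b<j)))

module _ {P : Pred ℕ 0ℓ} (P? : Decidable P) where

  least-≥ : ∀ {i c} → i ≤ c → P c → ∃ λ b → i ≤ b × P b × (∀ {j} → i ≤ j → j < b → ¬ P j)
  least-≥ {i} {c} i≤c pc = search (c ∸ i) (subst P (sym (m∸n+n≡m i≤c)) pc)
    where
    search : ∀ d {i} → P (d + i) → ∃ λ b → i ≤ b × P b × (∀ {j} → i ≤ j → j < b → ¬ P j)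
    search zero    {i} pi = i , ≤-refl , pi , λ i≤j j<i → ⊥-elim (<⇒≱ j<i i≤j)
    search (suc d) {i} p with P? i
    ... | yes pi = i , ≤-refl , pi , λ i≤j j<i → ⊥-elim (<⇒≱ j<i i≤j)
    ... | no ¬pi with search d {suc i} (subst P (sym (+-suc d i)) p)
    ... | b , i<b , pb , none-below = b , <⇒≤ i<b , pb , none-from-i
      where
      none-from-i : ∀ {j} → i ≤ j → j < b → ¬ P j
      none-from-i i≤j j<b with m≤n⇒m<n∨m≡n i≤j
      ... | inj₁ i<j  = none-below i<j j<b
      ... | inj₂ refl = ¬pi

module LeastJ₁From (n : ℕ) (t : List ℕ) (∣t∣+1≡n : suc (length t) ≡ n) (uniq : Unique t)
                   (k i b : ℕ) (k∉t : k ∉ t) (1≤i : 1 ≤ i) (i≢k : i ≢ k) (i≤b : i ≤ b)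
                   (b∈J₁ : b ∈ J₁ t) (b-least : ∀ {j} → i ≤ j → j < b → j ∉ J₁ t) where

  private
    ∣t∣ = length t

  1≤b : 1 ≤ b
  1≤b = proj₁ (∈-matchSet⁻ suc t ∣t∣ b∈J₁)

  b≤∣t∣ : b ≤ ∣t∣
  b≤∣t∣ = proj₁ (proj₂ (∈-matchSet⁻ suc t ∣t∣ b∈J₁))

  t-b : at t b ≡ suc b
  t-b = proj₂ (proj₂ (∈-matchSet⁻ suc t ∣t∣ b∈J₁))

  open InsertThenDelete t k i b 1≤i i≤b b≤∣t∣ renaming (u′ to t′; length-u′ to length-t′)

  private
    ≤∣t′∣⇒≤∣t∣ : ∀ {j} → j ≤ length t′ → j ≤ ∣t∣
    ≤∣t′∣⇒≤∣t∣ = subst (_ ≤_) length-t′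

    to-t : ∀ g {j} → at t′ j ≡ at t j → j ∈ matchSet g t′ (length t′) → j ∈ matchSet g t ∣t∣
    to-t g t′j≡tj = matchSet-transfer g t′ t length-t′ (sym t′j≡tj)

    to-t′ : ∀ g {j} → at t′ j ≡ at t j → j ∈ matchSet g t ∣t∣ → j ∈ matchSet g t′ (length t′)
    to-t′ g = matchSet-transfer g t t′ (sym length-t′)

    n∸1≡∣t∣ : n ∸ 1 ≡ ∣t∣
    n∸1≡∣t∣ = cong (_∸ 1) (sym ∣t∣+1≡n)

    shifted-not-fixed : ∀ {j} → i ≤ j → j < b → at t′ (suc j) ≢ suc j
    shifted-not-fixed i≤j j<b t′j+1≡ = b-least i≤j j<b
      (∈-matchSet⁺ suc t ∣t∣ (≤-trans 1≤i i≤j) (≤-trans (<⇒≤ j<b) b≤∣t∣)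
        (trans (sym (at-shifted i≤j j<b)) t′j+1≡))

  suc-b-only-at-b : ∀ {j} → 1 ≤ j → j ≤ ∣t∣ → at t j ≡ suc b → j ≡ b
  suc-b-only-at-b 1≤j j≤∣t∣ tj≡ = at-injective uniq 1≤j j≤∣t∣ 1≤b b≤∣t∣ (trans tj≡ (sym t-b))

  k≢suc-b : k ≢ suc b
  k≢suc-b refl = k∉t (subst (_∈ t) t-b (at-∈ t 1≤b b≤∣t∣))

  suc-b∉t′ : suc b ∉ t′
  suc-b∉t′ sb∈t′ with ∈⇒at t′ sb∈t′
  ... | j , 1≤j , j≤∣t′∣ , t′j≡ with region i b j
  ... | before j<i = <⇒≢ (≤-trans j<i i≤b) (at-t≡suc-b (trans (sym (at-before j<i)) t′j≡))
    where at-t≡suc-b = suc-b-only-at-b 1≤j (≤∣t′∣⇒≤∣t∣ j≤∣t′∣)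
  ... | inserted = k≢suc-b (trans (sym at-inserted) t′j≡)
  ... | shifted i≤j j<b = <⇒≢ j<b (at-t≡suc-b (trans (sym (at-shifted i≤j j<b)) t′j≡))
    where at-t≡suc-b = suc-b-only-at-b (≤-trans 1≤i i≤j) (≤-trans (<⇒≤ j<b) b≤∣t∣)
  ... | after b<j = <⇒≢ b<j (sym (at-t≡suc-b (trans (sym (at-after b<j)) t′j≡)))
    where at-t≡suc-b = suc-b-only-at-b 1≤j (≤∣t′∣⇒≤∣t∣ j≤∣t′∣)

  t′-b≢suc-b : at t′ b ≢ suc b
  t′-b≢suc-b t′b≡ = suc-b∉t′ (subst (_∈ t′) t′b≡ (at-∈ t′ 1≤b (subst (b ≤_) (sym length-t′) b≤∣t∣)))

  b∉J₁t′ : b ∉ J₁ t′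
  b∉J₁t′ b∈ = t′-b≢suc-b (proj₂ (proj₂ (∈-matchSet⁻ suc t′ (length t′) b∈)))

  J₀-window : ℕ → Set
  J₀-window j = (rho n t ≤ j × j ≤ i ∸ 1) ⊎ (rho n t ⊔ suc b ≤ j × j ≤ n ∸ 1)

  J₀t′⇒ : ∀ {j} → j ∈ J₀ t′ → j ∈ J₀ t × J₀-window j
  J₀t′⇒ {j} j∈ with region i b j | proj₂ (proj₂ (∈-matchSet⁻ (λ j → j) t′ (length t′) j∈))
  ... | before j<i | _ = j∈J₀t , inj₁ (foldr-⊓-≤ j∈J₀t , suc[m]≤n⇒m≤pred[n] j<i)
    where j∈J₀t = to-t (λ j → j) (at-before j<i) j∈
  ... | inserted | t′i≡i = ⊥-elim (i≢k (trans (sym t′i≡i) at-inserted))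
  ... | shifted i≤j j<b | t′j+1≡j+1 = ⊥-elim (shifted-not-fixed i≤j j<b t′j+1≡j+1)
  ... | after b<j | _ = j∈J₀t , inj₂ (⊔-lub (foldr-⊓-≤ j∈J₀t) b<j , subst (j ≤_) (sym n∸1≡∣t∣) j≤∣t∣)
    where
    j∈J₀t = to-t (λ j → j) (at-after b<j) j∈
    j≤∣t∣ = proj₁ (proj₂ (∈-matchSet⁻ (λ j → j) t ∣t∣ j∈J₀t))

  J₀t′⇐ : ∀ {j} → j ∈ J₀ t × J₀-window j → j ∈ J₀ t′
  J₀t′⇐ (j∈ , inj₁ (_ , j≤i∸1)) =
    to-t′ (λ j → j) (at-before (m≤pred[n]⇒suc[m]≤n {{>-nonZero 1≤i}} j≤i∸1)) j∈
  J₀t′⇐ (j∈ , inj₂ (b<j , _)) =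
    to-t′ (λ j → j) (at-after (≤-trans (m≤n⊔m (rho n t) (suc b)) b<j)) j∈

  J₁t′⊆below-b∪J₁t : ∀ {x} → x ∈ J₁ t′ → x < b ⊎ (b < x × x ∈ J₁ t)
  J₁t′⊆below-b∪J₁t {x} x∈ with <-cmp x b
  ... | tri< x<b _ _  = inj₁ x<b
  ... | tri≈ _ refl _ = ⊥-elim (b∉J₁t′ x∈)
  ... | tri> _ _ b<x  = inj₂ (b<x , to-t suc (at-after b<x) x∈)

  J₁t-above-b⊆J₁t′ : ∀ {x} → b < x → x ∈ J₁ t → x ∈ J₁ t′
  J₁t-above-b⊆J₁t′ b<x = to-t′ suc (at-after b<x)

  b≤lam : b ≤ lam t
  b≤lam = ≤-foldr-⊔ b∈J₁

  lam∈J₁ : lam t ∈ J₁ t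
  lam∈J₁ = foldr-⊔-∈ (≤-trans 1≤b b≤lam)

  lam-decreases : b ≡ lam t → lam t′ < lam t
  lam-decreases refl = foldr-⊔-< (≤-trans 1≤b b≤lam) (All.tabulate below-b)
    where
    below-b : ∀ {x} → x ∈ J₁ t′ → x < b
    below-b x∈ with J₁t′⊆below-b∪J₁t x∈
    ... | inj₁ x<b          = x<b
    ... | inj₂ (b<x , x∈J₁) = ⊥-elim (<⇒≱ b<x (≤-foldr-⊔ x∈J₁))

  lam-preserved : b < lam t → lam t′ ≡ lam t
  lam-preserved b<lam =
    ≤-antisym (foldr-⊔-≤ (All.tabulate ≤lam)) (≤-foldr-⊔ (J₁t-above-b⊆J₁t′ b<lam lam∈J₁))
    where
    ≤lam : ∀ {x} → x ∈ J₁ t′ → x ≤ lam t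
    ≤lam x∈ with J₁t′⊆below-b∪J₁t x∈
    ... | inj₁ x<b        = ≤-trans (<⇒≤ x<b) b≤lam
    ... | inj₂ (_ , x∈J₁) = ≤-foldr-⊔ x∈J₁

  δ⃖J₁-increases : b < lam t → δ⃖ (J₁ t) <L δ⃖ (J₁ t′)
  δ⃖J₁-increases b<lam =
    subst (λ m → δ⃖ (J₁ t) <L δ⃖ (filter (λ j → at t′ j ≟ suc j) (range1 m))) (sym length-t′)
      (δ⃖-filter-range1-<L (λ j → at t j ≟ suc j) (λ j → at t′ j ≟ suc j) 1≤b b≤∣t∣ agree t-b t′-b≢suc-b
        (proj₂ (proj₂ lam-facts)) b<lam (proj₁ (proj₂ lam-facts)))
    where
    lam-facts = ∈-matchSet⁻ suc t ∣t∣ lam∈J₁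

    agree : ∀ {j} → b < j → j ≤ ∣t∣ → (at t j ≡ suc j) ⇔ (at t′ j ≡ suc j)
    agree b<j _ = mk⇔ (trans (at-after b<j)) (trans (sym (at-after b<j)))

lemma4p15 : (n k : ℕ) → 4 ≤ n → 1 ≤ k → k ≤ n →
    (t : List ℕ) → suc (length t) ≡ n → Unique t → All (λ x → 1 ≤ x × x ≤ n) t → k ∉ t →
    (i : ℕ) → 1 ≤ i → i ≤ lam t → (i ≡ k → ⊥) →
    let s = σ i k t in
    Σ ℕ λ b →
      let t′ = ∂ (suc b) s in
      (b ∈ J₁ t × i ≤ b × (∀ j → j ∈ J₁ t → i ≤ j → b ≤ j)) ×
      (i ≤ b × b ≤ lam t) ×
      suc b ∉ t′ ×
      (∀ j → (j ∈ J₀ t′) ⇔ (j ∈ J₀ t × ((rho n t ≤ j × j ≤ i ∸ 1) ⊎ (rho n t ⊔ suc b ≤ j × j ≤ n ∸ 1)))) ×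
      (b ≡ lam t → lam t′ < lam t) ×
      (b < lam t → lam t′ ≡ lam t × δ⃖ (J₁ t) <L δ⃖ (J₁ t′))
lemma4p15 n k _ _ _ t ∣t∣+1≡n uniq _ k∉t i 1≤i i≤lam i≢k
  with least-≥ (_∈? J₁ t) i≤lam (foldr-⊔-∈ (≤-trans 1≤i i≤lam))
... | b , i≤b , b∈J₁ , b-least =
  b , (b∈J₁ , i≤b , b-minimal) , (i≤b , b≤lam) , suc-b∉t′ ,
  (λ _ → mk⇔ J₀t′⇒ J₀t′⇐) ,
  lam-decreases , (λ b<lam → lam-preserved b<lam , δ⃖J₁-increases b<lam)
  where
  open LeastJ₁From n t ∣t∣+1≡n uniq k i b k∉t 1≤i i≢k i≤b b∈J₁ b-least

  b-minimal : ∀ j → j ∈ J₁ t → i ≤ j → b ≤ j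
  b-minimal j j∈ i≤j = ≮⇒≥ (λ j<b → b-least i≤j j<b j∈)
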